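{- Let $G$ be a graph that contains neither $C_4$ nor $D_4$ as an induced subgraph, and let $S\subseteq V(G)$. Let $\hat G$ be the bipartite graph with vertex set $V(G)\cup V_{\mathcal{C}}$, where $V_{\mathcal{C}}$ contains one vertex $v_C$ for each maximal clique $C$ of $G$, and where $v\in V(G)$ is adjacent to $v_C$ if and only if $v\in V(C)$ and $v$ belongs to at least two maximal cliques of $G$. Then $G\setminus S$ is a block graph if and only if $\hat G\setminus S$ is acyclic.
   Context: $C_4$ is the cycle on four vertices and $D_4=K_4-e$. A block graph is a graph in which every maximal $2$-connected subgraph is a clique; equivalently, a graph with no induced cycle of length at least four and no induced $D_4$. -}

module Defs where

open import Data.Nat using (ℕ; _≤_)
open import Data.Bool using (Bool; true; false; T)
open import Data.Fin using (Fin)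
open import Data.Fin.Patterns using (0F; 1F; 2F; 3F)
open import Data.Fin.Subset using (Subset; _∈_; _⊆_)
open import Data.List using (List; length; _++_; take)
open import Data.List.Relation.Unary.Linked using (Linked)
open import Data.List.Relation.Unary.Unique.Propositional using (Unique)
open import Data.Product using (Σ; Σ-syntax; _×_)
open import Data.Sum using (_⊎_; inj₁; inj₂)
open import Data.Empty using (⊥)
open import Relation.Nullary using (¬_)
open import Relation.Binary.PropositionalEquality using (_≡_; _≢_)

record Graph : Set₁ where
  field
    Vtx : Set
    _∼_ : Vtx → Vtx → Set

open Graph public

-- Vertex deletion: the induced subgraph on the vertices NOT satisfying P.
-- The proof that a vertex is kept is irrelevant, so kept vertices are
-- equal iff their underlying vertices are equal.
record Kept (G : Graph) (P : Vtx G → Set) : Set where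
  constructor keep
  field
    vtx : Vtx G
    .notDel : ¬ P vtx

open Kept public

_∖_ : (G : Graph) → (Vtx G → Set) → Graph
G ∖ P = record { Vtx = Kept G P ; _∼_ = λ a b → _∼_ G (vtx a) (vtx b) }

IsCycle : (G : Graph) → List (Vtx G) → Set
IsCycle G vs = 3 ≤ length vs × Unique vs × Linked (_∼_ G) (vs ++ take 1 vs)

Acyclic : Graph → Set
Acyclic G = (vs : List (Vtx G)) → ¬ IsCycle G vs

module _ (G : Graph) where

  _⊆ᵖ_ : (Vtx G → Set) → (Vtx G → Set) → Set
  W ⊆ᵖ W' = ∀ v → W v → W' v

  data Reach (U : Vtx G → Set) : Vtx G → Vtx G → Set where
    here : ∀ {u} → U u → Reach U u u
    step : ∀ {u w v} → U u → _∼_ G u w → Reach U w v → Reach U u v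

  Connected : (Vtx G → Set) → Set
  Connected U = ∀ u v → U u → U v → Reach U u v

  TwoConnected : (Vtx G → Set) → Set
  TwoConnected W =
    (Σ[ a ∈ Vtx G ] Σ[ b ∈ Vtx G ] Σ[ c ∈ Vtx G ]
       W a × W b × W c × a ≢ b × b ≢ c × a ≢ c)
    × Connected W
    × (∀ x → W x → Connected (λ v → W v × v ≢ x))

  MaxTwoConnected : (Vtx G → Set) → Set₁
  MaxTwoConnected W =
    TwoConnected W × (∀ W' → W ⊆ᵖ W' → TwoConnected W' → W' ⊆ᵖ W)

  IsClique : (Vtx G → Set) → Set
  IsClique W = ∀ u v → W u → W v → u ≢ v → _∼_ G u v

  IsBlockGraph : Set₁
  IsBlockGraph = ∀ W → MaxTwoConnected W → IsClique W

record SimpleGraph (n : ℕ) : Set where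
  field
    adj    : Fin n → Fin n → Bool
    sym    : ∀ u v → adj u v ≡ adj v u
    irrefl : ∀ v → adj v v ≡ false

open SimpleGraph public

toGraph : ∀ {n} → SimpleGraph n → Graph
toGraph {n} G = record { Vtx = Fin n ; _∼_ = λ u v → T (adj G u v) }

InducedCopy : ∀ {n} → SimpleGraph n → (Fin 4 → Fin 4 → Bool) → Set
InducedCopy {n} G H =
  Σ[ f ∈ (Fin 4 → Fin n) ]
    (∀ i j → f i ≡ f j → i ≡ j) × (∀ i j → adj G (f i) (f j) ≡ H i j)

C4 : Fin 4 → Fin 4 → Bool
C4 0F 1F = true
C4 1F 0F = true
C4 1F 2F = true
C4 2F 1F = true
C4 2F 3F = true
C4 3F 2F = true
C4 3F 0F = true
C4 0F 3F = true
C4 _  _  = false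

D4 : Fin 4 → Fin 4 → Bool
D4 0F 0F = false
D4 1F 1F = false
D4 2F 2F = false
D4 3F 3F = false
D4 0F 2F = false
D4 2F 0F = false
D4 _  _  = true

module _ {n : ℕ} (G : SimpleGraph n) where

  IsCliqueS : Subset n → Set
  IsCliqueS C = ∀ u v → u ∈ C → v ∈ C → u ≢ v → T (adj G u v)

  IsMaxClique : Subset n → Set
  IsMaxClique C = IsCliqueS C × (∀ D → IsCliqueS D → C ⊆ D → D ⊆ C)

  -- one vertex v_C per maximal clique C (proof irrelevant, so v_C is
  -- determined by C)
  record MaxClique : Set where
    constructor vC
    field
      clq : Subset n
      .isMax : IsMaxClique clq

  open MaxClique public

  InTwoMaxCliques : Fin n → Set
  InTwoMaxCliques v =
    Σ[ C ∈ Subset n ] Σ[ D ∈ Subset n ]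
      IsMaxClique C × IsMaxClique D × C ≢ D × v ∈ C × v ∈ D

  HatAdj : Fin n ⊎ MaxClique → Fin n ⊎ MaxClique → Set
  HatAdj (inj₁ v) (inj₂ C) = IsMaxClique (clq C) × v ∈ clq C × InTwoMaxCliques v
  HatAdj (inj₂ C) (inj₁ v) = IsMaxClique (clq C) × v ∈ clq C × InTwoMaxCliques v
  HatAdj _ _ = ⊥

  Ĝ : Graph
  Ĝ = record { Vtx = Fin n ⊎ MaxClique ; _∼_ = HatAdj }

InS : ∀ {n} {G : SimpleGraph n} → Subset n → Fin n ⊎ MaxClique G → Set
InS S (inj₁ v) = v ∈ S
InS S (inj₂ _) = ⊥

module Submission where

-- Write H = G ∖ S.  A vertex of H has an edge in Ĝ ∖ S exactly when it lies in two maximal cliques.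
--
-- If H is not a block graph, some 2-connected vertex set W contains non-adjacent u and v.  A walk
-- u w … v inside W leaves the maximal clique C ⊇ {u, w} along an edge y y′, which lies in another
-- maximal clique D.  By 2-connectivity a vertex of C ∩ W other than y reaches y′ avoiding y;
-- replacing every edge of that walk by a maximal clique containing it gives a walk from v_C to v_D
-- in Ĝ ∖ S avoiding y, which the edges y v_C and y v_D close into a cycle.
--
-- Conversely, a cycle a C₀ b₁ C₁ b₂ … of Ĝ ∖ S alternates between vertices and cliques, and its
-- vertices form a cycle of H.  In a block graph a cycle lies in a single block, which is a clique,
-- so b₂ is adjacent to a as well as to b₁.  Without induced D₄, a common neighbour of two vertices
-- of a maximal clique belongs to it, and two maximal cliques sharing two vertices coincide; hence
-- b₂ ∈ C₀ and C₀ = C₁, contradicting that the cycle is simple (a 4-cycle a C₀ b₁ C₁ contradicts it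
-- directly).

open import Defs renaming (sym to adj-sym)
open import Data.Nat using (ℕ; zero; suc; _≤_; s≤s; z≤n)
open import Data.Nat.Properties using (≤-trans; n≤1+n)
open import Data.Bool as Bool using (Bool; true; false; T)
open import Data.Bool.Properties using (T-≡; ¬-not)
open import Data.Fin using (Fin; zero; suc) renaming (_≟_ to _≟ᶠ_)
open import Data.Fin.Patterns using (0F; 1F; 2F; 3F)
open import Data.Fin.Properties using (all?)
open import Data.Fin.Subset using (Subset; _∈_; _⊆_; ⁅_⁆; _∪_)
open import Data.Fin.Subset.Properties using (_∈?_; x∈⁅x⁆; x∈⁅y⁆⇒x≡y; x∈p∪q⁻; p⊆p∪q; q⊆p∪q; ⊆-antisym)
open import Data.List using (List; []; _∷_; _++_; [_]; take; length; allFin)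
open import Data.List.Properties using (++-assoc; ++-identityʳ; length-++-comm)
open import Data.List.Relation.Unary.Linked as Linked using (Linked; []; [-]; _∷_)
open import Data.List.Relation.Unary.All as All using (All; []; _∷_)
open import Data.List.Relation.Unary.All.Properties using (¬Any⇒All¬)
open import Data.List.Relation.Unary.Any using (here; there)
open import Data.List.Relation.Unary.AllPairs as AllPairs using ([]; _∷_)
open import Data.List.Relation.Unary.Unique.Propositional using (Unique)
open import Data.List.Relation.Unary.Unique.Propositional.Properties using (++⁺; Unique[x∷xs]⇒x∉xs)
open import Data.List.Membership.Propositional using () renaming (_∈_ to _∈ₗ_; _∉_ to _∉ₗ_)
open import Data.List.Membership.Propositional.Properties using (∈-∃++; ∈-allFin)
import Data.List.Membership.DecPropositional as DecMembership
open import Data.List.Relation.Binary.Permutation.Propositional using (_↭_; prep; ↭-sym; ↭-trans)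
open import Data.List.Relation.Binary.Permutation.Propositional.Properties using (∈-resp-↭; shift; ++-comm)
open import Data.Product using (Σ-syntax; _×_; _,_; proj₁; proj₂)
open import Data.Sum using (_⊎_; inj₁; inj₂)
open import Data.Empty using (⊥-elim)
open import Data.Empty.Irrelevant using () renaming (⊥-elim to ⊥-elimᵢ)
open import Data.Vec.Properties using (≡-dec)
open import Function using (_∘_)
open import Function.Bundles using (Equivalence; _⇔_; mk⇔)
open import Relation.Nullary using (¬_; Dec; yes; no)
open import Relation.Nullary.Decidable using (_→-dec_; ¬?)
open import Relation.Nullary.Decidable.Core using (T?; decidable-stable; ¬¬-excluded-middle)
open import Relation.Nullary.Negation.Core using (Stable; stable; ¬¬-map)
open import Relation.Binary.Definitions using (DecidableEquality)
open import Relation.Binary.PropositionalEquality using (_≡_; _≢_; refl; sym; trans; cong; subst; ≢-sym)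

module _ {A : Set} {R : A → A → Set} where

  linked-prefix : ∀ xs {ys} → Linked R (xs ++ ys) → Linked R xs
  linked-prefix []           _        = []
  linked-prefix (_ ∷ [])     _        = [-]
  linked-prefix (_ ∷ y ∷ xs) (r ∷ lk) = r ∷ linked-prefix (y ∷ xs) lk

  linked-snoc : ∀ {x} xs {y z} → Linked R (x ∷ xs ++ [ y ]) → R y z →
                Linked R ((x ∷ xs ++ [ y ]) ++ [ z ])
  linked-snoc []       (r ∷ [-]) r′ = r ∷ r′ ∷ [-]
  linked-snoc (_ ∷ xs) (r ∷ lk)  r′ = r ∷ linked-snoc xs lk r′

distinct-neighbours : ∀ {A : Set} {xs : List A} → 2 ≤ length xs → Unique xs → Linked _≢_ (xs ++ take 1 xs)
distinct-neighbours {xs = []}        ()        _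
distinct-neighbours {xs = _ ∷ []}    (s≤s ())  _
distinct-neighbours {xs = x ∷ _ ∷ _} _         (x∉@(x≢y ∷ _) ∷ uniq) = x≢y ∷ go x∉ uniq
  where
  go : ∀ {z zs} → All (x ≢_) (z ∷ zs) → Unique (z ∷ zs) → Linked _≢_ (z ∷ zs ++ [ x ])
  go {zs = []}    (x≢z ∷ [])   _                 = ≢-sym x≢z ∷ [-]
  go {zs = _ ∷ _} (_ ∷ x∉zs)   ((z≢w ∷ _) ∷ uniq) = z≢w ∷ go x∉zs uniq

¬¬-shiftᶠ : ∀ {m} {P : Fin m → Set} → (∀ i → ¬ ¬ P i) → ¬ ¬ (∀ i → P i)
¬¬-shiftᶠ {zero}  _ k = k λ ()
¬¬-shiftᶠ {suc m} f k =
  f zero λ p₀ → ¬¬-shiftᶠ (f ∘ suc) λ pₛ → k λ { zero → p₀ ; (suc i) → pₛ i }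

module _ {Γ : Graph} where

  open Graph Γ using () renaming (Vtx to V; _∼_ to _~_)

  reach-start : ∀ {U a b} → Reach Γ U a b → U a
  reach-start (here Ua)     = Ua
  reach-start (step Ua _ _) = Ua

  reach-map : ∀ {U U′ : V → Set} {a b} → (∀ {z} → U z → U′ z) → Reach Γ U a b → Reach Γ U′ a b
  reach-map f (here Ua)       = here (f Ua)
  reach-map f (step Ua a~w r) = step (f Ua) a~w (reach-map f r)

  reach-trans : ∀ {U a b c} → Reach Γ U a b → Reach Γ U b c → Reach Γ U a c
  reach-trans (here _)        r′ = r′
  reach-trans (step Ua a~w r) r′ = step Ua a~w (reach-trans r r′)

  exit-edge : ∀ {U P : V → Set} {a b} → (∀ z → Dec (P z)) → Reach Γ U a b → P a → ¬ P b →
              Σ[ y ∈ V ] Σ[ y′ ∈ V ] (U y × U y′ × P y × ¬ P y′ × y ~ y′)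
  exit-edge P? (here _) Pa ¬Pb = ⊥-elim (¬Pb Pa)
  exit-edge P? (step {w = w} Ua a~w r) Pa ¬Pb with P? w
  ... | yes Pw  = exit-edge P? r Pw ¬Pb
  ... | no  ¬Pw = _ , w , Ua , reach-start r , Pa , ¬Pw , a~w

module Walks (Γ : Graph) where

  open Graph Γ using () renaming (Vtx to V; _∼_ to _~_)

  module Symmetric (~-sym : ∀ {a b} → a ~ b → b ~ a) where

    reach-sym : ∀ {U a b} → Reach Γ U a b → Reach Γ U b a
    reach-sym (here Ua)       = here Ua
    reach-sym (step Ua a~w r) = reach-trans (reach-sym r) (step (reach-start r) (~-sym a~w) (here Ua))

    reach-head : ∀ {h t a} → Linked _~_ (h ∷ t) → a ∈ₗ h ∷ t → Reach Γ (_∈ₗ h ∷ t) a h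
    reach-head _                      (here refl) = here (here refl)
    reach-head {t = _ ∷ _} (h~h′ ∷ lk) (there a∈) =
      reach-trans (reach-map there (reach-head lk a∈)) (step (there (here refl)) (~-sym h~h′) (here (here refl)))

    linked-reach : ∀ {xs a b} → Linked _~_ xs → a ∈ₗ xs → b ∈ₗ xs → Reach Γ (_∈ₗ xs) a b
    linked-reach {_ ∷ _} lk a∈ b∈ = reach-trans (reach-head lk a∈) (reach-sym (reach-head lk b∈))

  module Paths (_≟_ : DecidableEquality V) where

    open DecMembership _≟_ using () renaming (_∈?_ to _∈ₗ?_)

    data Path : V → V → List V → Set where
      stop : ∀ {a} → Path a a [ a ]
      _▸_  : ∀ {a w b xs} → a ~ w → Path w b xs → Path a b (a ∷ xs)

    infixr 5 _▸_

    path-last : ∀ {a b xs} → Path a b xs → b ∈ₗ xs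
    path-last stop    = here refl
    path-last (_ ▸ p) = there (path-last p)

    path→reach : ∀ {U a b xs} → Path a b xs → (∀ {z} → z ∈ₗ xs → U z) → Reach Γ U a b
    path→reach stop      inU = here (inU (here refl))
    path→reach (a~w ▸ p) inU = step (inU (here refl)) a~w (path→reach p (inU ∘ there))

    path-suffix : ∀ {a b u xs} → Path a b xs → Unique xs → u ∈ₗ xs →
                  Σ[ ys ∈ List V ] (Path u b ys × Unique ys × (∀ {z} → z ∈ₗ ys → z ∈ₗ xs))
    path-suffix p@stop    uniq (here refl) = _ , p , uniq , λ z∈ → z∈
    path-suffix p@(_ ▸ _) uniq (here refl) = _ , p , uniq , λ z∈ → z∈
    path-suffix (_ ▸ p) (_ ∷ uniq) (there u∈) with path-suffix p uniq u∈
    ... | ys , q , uniqʸ , ys⊆ = ys , q , uniqʸ , there ∘ ys⊆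

    walk→path : ∀ {U a b} → Reach Γ U a b →
                Σ[ xs ∈ List V ] (Path a b xs × Unique xs × (∀ {z} → z ∈ₗ xs → U z))
    walk→path (here Ua) = _ , stop , [] ∷ [] , λ { (here refl) → Ua }
    walk→path {a = a} (step Ua a~w r) with walk→path r
    ... | xs , p , uniq , inU with a ∈ₗ? xs
    ...   | no a∉ =
      a ∷ xs , a~w ▸ p , ¬Any⇒All¬ xs a∉ ∷ uniq , λ { (here refl) → Ua ; (there z∈) → inU z∈ }
    ...   | yes a∈ with path-suffix p uniq a∈
    ...     | ys , q , uniqʸ , ys⊆ = ys , q , uniqʸ , inU ∘ ys⊆

    path-linked : ∀ {x a b c xs} → x ~ a → Path a b xs → b ~ c → Linked _~_ (x ∷ xs ++ [ c ])
    path-linked x~a stop      b~c = x~a ∷ b~c ∷ [-]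
    path-linked x~a (a~w ▸ p) b~c = x~a ∷ path-linked a~w p b~c

    acyclic-no-bypass : Acyclic Γ → ∀ {y p q} → y ~ p → q ~ y → p ≢ q → ¬ Reach Γ (_≢ y) p q
    acyclic-no-bypass acyclic {y} {q = q} y~p q~y p≢q r with walk→path r
    ... | xs , path , uniq , avoids =
      acyclic (y ∷ xs) (long path , ¬Any⇒All¬ xs (λ y∈ → avoids y∈ refl) ∷ uniq , path-linked y~p path q~y)
      where
      long : ∀ {xs} → Path _ q xs → 3 ≤ length (y ∷ xs)
      long stop        = ⊥-elim (p≢q refl)
      long (_ ▸ stop)  = s≤s (s≤s (s≤s z≤n))
      long (_ ▸ _ ▸ _) = s≤s (s≤s (s≤s z≤n))

module Cycles (Γ : Graph) where

  open Graph Γ using () renaming (Vtx to V; _∼_ to _~_)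
  open Walks Γ using (module Symmetric)

  rotate : ∀ {x xs} → IsCycle Γ (x ∷ xs) → IsCycle Γ (xs ++ [ x ])
  rotate {x} {xs@(_ ∷ ys)} (long , uniq , x~y ∷ lk) =
    subst (3 ≤_) (length-++-comm [ x ] xs) long ,
    ++⁺ (AllPairs.tail uniq) ([] ∷ []) (λ { (x∈ , here refl) → Unique[x∷xs]⇒x∉xs uniq x∈ }) ,
    linked-snoc ys lk x~y
  rotate {xs = []} (s≤s () , _)

  rotate-to : ∀ as {x bs} → IsCycle Γ (as ++ x ∷ bs) → IsCycle Γ (x ∷ bs ++ as)
  rotate-to []       {x} {bs} c = subst (λ zs → IsCycle Γ (x ∷ zs)) (sym (++-identityʳ bs)) c
  rotate-to (a ∷ as) {x} {bs} c =
    subst (λ zs → IsCycle Γ (x ∷ zs)) (++-assoc bs [ a ] as)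
      (rotate-to as (subst (IsCycle Γ) (++-assoc as (x ∷ bs) [ a ]) (rotate c)))

  cycle-minus : ∀ {vs x} → IsCycle Γ vs → x ∈ₗ vs →
                Σ[ ys ∈ List V ] (Linked _~_ ys × x ∉ₗ ys × vs ↭ x ∷ ys)
  cycle-minus {x = x} c x∈ with ∈-∃++ x∈
  ... | as , bs , refl with rotate-to as c
  ...   | _ , uniq , lk =
    bs ++ as , linked-prefix (bs ++ as) (Linked.tail lk) , Unique[x∷xs]⇒x∉xs uniq ,
    ↭-trans (shift x as bs) (prep x (++-comm as bs))

  module _ (~-sym : ∀ {a b} → a ~ b → b ~ a) (_≟_ : DecidableEquality V) where

    open Symmetric ~-sym
    open DecMembership _≟_ using () renaming (_∈?_ to _∈ₗ?_)

    cycle-connected-avoiding : ∀ {vs} → IsCycle Γ vs → ∀ x {k k′} → k ∈ₗ vs → k′ ∈ₗ vs →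
                               k ≢ x → k′ ≢ x → Reach Γ (λ z → z ∈ₗ vs × z ≢ x) k k′
    cycle-connected-avoiding {vs} c x k∈ k′∈ k≢x k′≢x with x ∈ₗ? vs
    ... | no x∉ = reach-map (λ z∈ → z∈ , λ { refl → x∉ z∈ })
                    (linked-reach (linked-prefix vs (proj₂ (proj₂ c))) k∈ k′∈)
    ... | yes x∈ with cycle-minus c x∈
    ...   | ys , lk , x∉ys , vs↭ =
      reach-map (λ z∈ → ∈-resp-↭ (↭-sym vs↭) (there z∈) , λ { refl → x∉ys z∈ })
                (linked-reach lk (remaining k∈ k≢x) (remaining k′∈ k′≢x))
      where
      remaining : ∀ {k} → k ∈ₗ vs → k ≢ x → k ∈ₗ ys
      remaining k∈ k≢x with ∈-resp-↭ vs↭ k∈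
      ... | here k≡x  = ⊥-elim (k≢x k≡x)
      ... | there k∈′ = k∈′

module Cliques {n : ℕ} (G : SimpleGraph n) where

  Adj : Fin n → Fin n → Set
  Adj u v = T (adj G u v)

  Adj-sym : ∀ {u v} → Adj u v → Adj v u
  Adj-sym {u} {v} = subst T (adj-sym G u v)

  Adj⇒≢ : ∀ {u v} → Adj u v → u ≢ v
  Adj⇒≢ {u} uv refl = subst T (irrefl G u) uv

  Addable : Fin n → Subset n → Set
  Addable w C = ∀ y → y ∈ C → y ≢ w → Adj w y

  addable? : ∀ w C → Dec (Addable w C)
  addable? w C = all? λ y → y ∈? C →-dec ¬? (y ≟ᶠ w) →-dec T? (adj G w y)

  ∈-insert⁻ : ∀ {u w} {C : Subset n} → u ∈ ⁅ w ⁆ ∪ C → u ≡ w ⊎ u ∈ C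
  ∈-insert⁻ {w = w} {C} u∈ with x∈p∪q⁻ ⁅ w ⁆ C u∈
  ... | inj₁ u∈w = inj₁ (x∈⁅y⁆⇒x≡y w u∈w)
  ... | inj₂ u∈C = inj₂ u∈C

  insert-clique : ∀ {w C} → IsCliqueS G C → Addable w C → IsCliqueS G (⁅ w ⁆ ∪ C)
  insert-clique clq w+ u v u∈ v∈ u≢v with ∈-insert⁻ u∈ | ∈-insert⁻ v∈
  ... | inj₁ refl | inj₁ refl = ⊥-elim (u≢v refl)
  ... | inj₁ refl | inj₂ v∈C  = w+ v v∈C (≢-sym u≢v)
  ... | inj₂ u∈C  | inj₁ refl = Adj-sym (w+ u u∈C u≢v)
  ... | inj₂ u∈C  | inj₂ v∈C  = clq u v u∈C v∈C u≢v

  extend : Fin n → Subset n → Subset n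
  extend w C with addable? w C
  ... | yes _ = ⁅ w ⁆ ∪ C
  ... | no  _ = C

  extend-⊇ : ∀ w C → C ⊆ extend w C
  extend-⊇ w C with addable? w C
  ... | yes _ = q⊆p∪q ⁅ w ⁆ C
  ... | no  _ = λ y∈ → y∈

  extend-clique : ∀ w C → IsCliqueS G C → IsCliqueS G (extend w C)
  extend-clique w C clq with addable? w C
  ... | yes w+ = insert-clique clq w+
  ... | no  _  = clq

  grow : List (Fin n) → Subset n → Subset n
  grow []       C = C
  grow (w ∷ ws) C = grow ws (extend w C)

  grow-⊇ : ∀ ws C → C ⊆ grow ws C
  grow-⊇ []       C = λ y∈ → y∈
  grow-⊇ (w ∷ ws) C = grow-⊇ ws (extend w C) ∘ extend-⊇ w C

  grow-clique : ∀ ws C → IsCliqueS G C → IsCliqueS G (grow ws C)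
  grow-clique []       C clq = clq
  grow-clique (w ∷ ws) C clq = grow-clique ws (extend w C) (extend-clique w C clq)

  grow-maximal : ∀ ws C {D} → IsCliqueS G D → grow ws C ⊆ D →
                 ∀ {w} → w ∈ₗ ws → w ∈ D → w ∈ grow ws C
  grow-maximal (w ∷ ws) C clqD grow⊆D (here refl) w∈D with addable? w C
  ... | yes _   = grow-⊇ ws _ (p⊆p∪q C (x∈⁅x⁆ w))
  ... | no  ¬w+ = ⊥-elim (¬w+ λ y y∈C y≢w → clqD w y w∈D (grow⊆D (grow-⊇ ws C y∈C)) (≢-sym y≢w))
  grow-maximal (_ ∷ ws) C clqD grow⊆D (there w∈) w∈D = grow-maximal ws _ clqD grow⊆D w∈ w∈D

  maxClique-⊇ : ∀ {C} → IsCliqueS G C → Σ[ D ∈ Subset n ] (IsMaxClique G D × C ⊆ D)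
  maxClique-⊇ {C} clq =
    grow (allFin n) C ,
    (grow-clique (allFin n) C clq ,
     λ D clqD grow⊆D w∈D → grow-maximal (allFin n) C clqD grow⊆D (∈-allFin _) w∈D) ,
    grow-⊇ (allFin n) C

  singleton-clique : ∀ b → IsCliqueS G ⁅ b ⁆
  singleton-clique b _ _ u∈ v∈ u≢v = ⊥-elim (u≢v (trans (x∈⁅y⁆⇒x≡y b u∈) (sym (x∈⁅y⁆⇒x≡y b v∈))))

  edge-maxClique : ∀ {a b} → Adj a b → Σ[ C ∈ Subset n ] (IsMaxClique G C × a ∈ C × b ∈ C)
  edge-maxClique {a} {b} ab
    with maxClique-⊇ (insert-clique (singleton-clique b) λ y y∈ _ → subst (Adj a) (sym (x∈⁅y⁆⇒x≡y b y∈)) ab)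
  ... | C , maxC , ab⊆C =
    C , maxC , ab⊆C (p⊆p∪q ⁅ b ⁆ (x∈⁅x⁆ a)) , ab⊆C (q⊆p∪q ⁅ a ⁆ ⁅ b ⁆ (x∈⁅x⁆ b))

  induced-injective : ∀ {H : Fin 4 → Fin 4 → Bool} (f : Fin 4 → Fin n) →
                      (∀ i j → adj G (f i) (f j) ≡ H i j) →
                      (∀ i j → H i j ≡ false → f i ≡ f j → i ≡ j) →
                      ∀ i j → f i ≡ f j → i ≡ j
  induced-injective {H} f table nonedge-injective i j fi≡fj with H i j in eq
  ... | true  = ⊥-elim (Adj⇒≢ (Equivalence.from T-≡ (trans (table i j) eq)) fi≡fj)
  ... | false = nonedge-injective i j eq fi≡fj

  module D4-free (noD4 : ¬ InducedCopy G D4) where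

    diamond-closed : ∀ {w a y b} → Adj a b → Adj w a → Adj w b → Adj y a → Adj y b → w ≢ y → Adj w y
    diamond-closed {w} {a} {y} {b} ab wa wb ya yb w≢y with T? (adj G w y)
    ... | yes wy = wy
    ... | no ¬wy = ⊥-elim (noD4 (f , induced-injective f table nonedge-injective , table))
      where
      f : Fin 4 → Fin n
      f 0F = w
      f 1F = a
      f 2F = y
      f 3F = b
      edge : ∀ {u v} → Adj u v → adj G u v ≡ true
      edge = Equivalence.to T-≡
      table : ∀ i j → adj G (f i) (f j) ≡ D4 i j
      table 0F 0F = irrefl G w
      table 0F 1F = edge wa
      table 0F 2F = ¬-not (¬wy ∘ Equivalence.from T-≡)
      table 0F 3F = edge wb
      table 1F 1F = irrefl G a
      table 1F 2F = edge (Adj-sym ya)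
      table 1F 3F = edge ab
      table 2F 2F = irrefl G y
      table 2F 3F = edge yb
      table 3F 3F = irrefl G b
      table 1F 0F = trans (adj-sym G a w) (table 0F 1F)
      table 2F 0F = trans (adj-sym G y w) (table 0F 2F)
      table 2F 1F = trans (adj-sym G y a) (table 1F 2F)
      table 3F 0F = trans (adj-sym G b w) (table 0F 3F)
      table 3F 1F = trans (adj-sym G b a) (table 1F 3F)
      table 3F 2F = trans (adj-sym G b y) (table 2F 3F)
      nonedge-injective : ∀ i j → D4 i j ≡ false → f i ≡ f j → i ≡ j
      nonedge-injective 0F 0F _  _   = refl
      nonedge-injective 1F 1F _  _   = refl
      nonedge-injective 2F 2F _  _   = refl
      nonedge-injective 3F 3F _  _   = refl
      nonedge-injective 0F 2F _  w≡y = ⊥-elim (w≢y w≡y)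
      nonedge-injective 2F 0F _  y≡w = ⊥-elim (w≢y (sym y≡w))
      nonedge-injective 0F 1F () _
      nonedge-injective 0F 3F () _
      nonedge-injective 1F 0F () _
      nonedge-injective 1F 2F () _
      nonedge-injective 1F 3F () _
      nonedge-injective 2F 1F () _
      nonedge-injective 2F 3F () _
      nonedge-injective 3F 0F () _
      nonedge-injective 3F 1F () _
      nonedge-injective 3F 2F () _

    common-neighbour∈maxClique : ∀ {C a b w} → IsMaxClique G C → a ∈ C → b ∈ C → a ≢ b →
                                 Adj w a → Adj w b → w ∈ C
    common-neighbour∈maxClique {C} {a} {b} {w} (clq , maximal) a∈C b∈C a≢b wa wb =
      maximal (⁅ w ⁆ ∪ C) (insert-clique clq w+) (q⊆p∪q ⁅ w ⁆ C) (p⊆p∪q C (x∈⁅x⁆ w))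
      where
      w+ : Addable w C
      w+ y y∈C y≢w with y ≟ᶠ a | y ≟ᶠ b
      ... | yes refl | _        = wa
      ... | no _     | yes refl = wb
      ... | no y≢a   | no y≢b   = diamond-closed (clq a b a∈C b∈C a≢b) wa wb
                                     (clq y a y∈C a∈C y≢a) (clq y b y∈C b∈C y≢b) (≢-sym y≢w)

    maxCliques-sharing-edge : ∀ {C D a b} → IsMaxClique G C → IsMaxClique G D →
                              a ∈ C → b ∈ C → a ∈ D → b ∈ D → a ≢ b → C ≡ D
    maxCliques-sharing-edge {C} {D} {a} {b} maxC@(clqC , _) (clqD , maximalD) a∈C b∈C a∈D b∈D a≢b =
      ⊆-antisym (maximalD C clqC D⊆C) D⊆C
      where
      D⊆C : D ⊆ C
      D⊆C {z} z∈D with z ≟ᶠ a | z ≟ᶠ b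
      ... | yes refl | _        = a∈C
      ... | no _     | yes refl = b∈C
      ... | no z≢a   | no z≢b   =
        common-neighbour∈maxClique maxC a∈C b∈C a≢b (clqD z a z∈D a∈D z≢a) (clqD z b z∈D b∈D z≢b)

module Deletion {n : ℕ} (G : SimpleGraph n) (S : Subset n) where

  open Cliques G

  H : Graph
  H = toGraph G ∖ (λ v → v ∈ S)

  Ĝ∖S : Graph
  Ĝ∖S = Ĝ G ∖ InS {n} {G} S

  keep-≡ : ∀ {Γ P} {x y : Kept Γ P} → vtx x ≡ vtx y → x ≡ y
  keep-≡ refl = refl

  _≟ˢ_ : DecidableEquality (Subset n)
  _≟ˢ_ = ≡-dec Bool._≟_

  _≟ᴴ_ : DecidableEquality (Vtx H)
  x ≟ᴴ y with vtx x ≟ᶠ vtx y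
  ... | yes x≡y = yes (keep-≡ x≡y)
  ... | no  x≢y = no (x≢y ∘ cong vtx)

  _≟ᴳ_ : DecidableEquality (Vtx Ĝ∖S)
  keep (inj₁ a) _ ≟ᴳ keep (inj₁ b) _ with a ≟ᶠ b
  ... | yes refl = yes refl
  ... | no  a≢b  = no λ { refl → a≢b refl }
  keep (inj₁ _) _ ≟ᴳ keep (inj₂ _) _ = no λ ()
  keep (inj₂ _) _ ≟ᴳ keep (inj₁ _) _ = no λ ()
  keep (inj₂ (vC C _)) _ ≟ᴳ keep (inj₂ (vC D _)) _ with C ≟ˢ D
  ... | yes refl = yes refl
  ... | no  C≢D  = no λ { refl → C≢D refl }

  vertex : Vtx H → Vtx Ĝ∖S
  vertex (keep v v∉S) = keep (inj₁ v) v∉S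

  clique : (C : Subset n) → .(IsMaxClique G C) → Vtx Ĝ∖S
  clique C maxC = keep (inj₂ (vC C maxC)) λ ()

  vertex-injective : ∀ {a b} → vertex a ≡ vertex b → a ≡ b
  vertex-injective refl = refl

  clique-injective : ∀ {C D} .{maxC maxD} → clique C maxC ≡ clique D maxD → C ≡ D
  clique-injective refl = refl

  via-shared-vertex : ∀ {a y C D} (maxC : IsMaxClique G C) (maxD : IsMaxClique G D) →
                      a ≢ y → vtx a ∈ C → vtx a ∈ D →
                      Reach Ĝ∖S (_≢ vertex y) (clique C maxC) (clique D maxD)
  via-shared-vertex {a} {C = C} {D} maxC maxD a≢y a∈C a∈D with C ≟ˢ D
  ... | yes refl = here λ ()
  ... | no  C≢D  = step (λ ()) (maxC , a∈C , two) (step (a≢y ∘ vertex-injective) (maxD , a∈D , two) (here λ ()))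
    where
    two : InTwoMaxCliques G (vtx a)
    two = C , D , maxC , maxD , C≢D , a∈C , a∈D

  lift-walk : ∀ {y a b C D} (maxC : IsMaxClique G C) (maxD : IsMaxClique G D) →
              Reach H (_≢ y) a b → vtx a ∈ C → vtx b ∈ D →
              Reach Ĝ∖S (_≢ vertex y) (clique C maxC) (clique D maxD)
  lift-walk maxC maxD (here a≢y) a∈C a∈D = via-shared-vertex maxC maxD a≢y a∈C a∈D
  lift-walk maxC maxD (step a≢y a~w r) a∈C b∈D with edge-maxClique a~w
  ... | E , maxE , a∈E , w∈E =
    reach-trans (via-shared-vertex maxC maxE a≢y a∈C a∈E) (lift-walk maxE maxD r w∈E b∈D)

  module _ (acyclic : Acyclic Ĝ∖S) where

    open Walks.Paths Ĝ∖S _≟ᴳ_ using (acyclic-no-bypass)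

    no-exit-edge : ∀ {W : Vtx H → Set} {C c y y′} → (∀ x → W x → Connected H (λ v → W v × v ≢ x)) →
                   IsMaxClique G C → W c → vtx c ∈ C → c ≢ y →
                   W y → W y′ → vtx y ∈ C → ¬ vtx y′ ∈ C → ¬ Adj (vtx y) (vtx y′)
    no-exit-edge {W} {C} {c} {y} {y′} connected-minus maxC Wc c∈C c≢y Wy Wy′ y∈C y′∉C y~y′
      with edge-maxClique y~y′
    ... | D , maxD , y∈D , y′∈D =
      acyclic-no-bypass acyclic (maxC , y∈C , two) (maxD , y∈D , two) (C≢D ∘ clique-injective)
        (lift-walk maxC maxD (reach-map proj₂ c⇝y′) c∈C y′∈D)
      where
      C≢D : C ≢ D
      C≢D refl = y′∉C y′∈D
      two : InTwoMaxCliques G (vtx y)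
      two = C , D , maxC , maxD , C≢D , y∈C , y∈D
      c⇝y′ : Reach H (λ v → W v × v ≢ y) c y′
      c⇝y′ = connected-minus y Wy c y′ (Wc , c≢y) (Wy′ , Adj⇒≢ y~y′ ∘ cong vtx ∘ sym)

    acyclic⇒twoConnected-clique : ∀ {W : Vtx H → Set} → TwoConnected H W → IsClique H W
    acyclic⇒twoConnected-clique {W} (_ , connected , connected-minus) u v Wu Wv u≢v =
      decidable-stable (T? _) λ ¬uv → no-walk ¬uv (connected u v Wu Wv)
      where
      no-walk : ¬ Adj (vtx u) (vtx v) → ¬ Reach H W u v
      no-walk _   (here _) = u≢v refl
      no-walk ¬uv (step _ u~w w⇝v) with edge-maxClique u~w
      ... | C , maxC , u∈C , w∈C
        with exit-edge (λ z → vtx z ∈? C) w⇝v w∈C (λ v∈C → ¬uv (proj₁ maxC _ _ u∈C v∈C (u≢v ∘ keep-≡)))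
      ...   | y , y′ , Wy , Wy′ , y∈C , y′∉C , y~y′ with u ≟ᴴ y
      ...     | no  u≢y  = no-exit-edge {W} connected-minus maxC Wu u∈C u≢y Wy Wy′ y∈C y′∉C y~y′
      ...     | yes refl = no-exit-edge {W} connected-minus maxC (reach-start w⇝v) w∈C
                             (Adj⇒≢ (Adj-sym u~w) ∘ cong vtx) Wy Wy′ y∈C y′∉C y~y′

    acyclic⇒blockGraph : IsBlockGraph H
    acyclic⇒blockGraph _ (twoConnected , _) = acyclic⇒twoConnected-clique twoConnected

  ¬¬-shiftᴴ : ∀ {P : Vtx H → Set} → (∀ v → ¬ ¬ P v) → ¬ ¬ (∀ v → P v)
  ¬¬-shiftᴴ {P} f k = ¬¬-shiftᶠ kept λ g → k λ { (keep v v∉S) → g v v∉S }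
    where
    kept : ∀ v → ¬ ¬ (.(v∉S : ¬ v ∈ S) → P (keep v v∉S))
    kept v with v ∈? S
    ... | yes v∈S = λ k′ → k′ λ v∉S → ⊥-elimᵢ (v∉S v∈S)
    ... | no  v∉S = λ k′ → f (keep v v∉S) λ p → k′ λ _ → p

  open Walks H using (module Symmetric)
  open Symmetric (λ {u} {v} → Adj-sym {vtx u} {vtx v}) using (reach-sym; linked-reach)
  open Walks.Paths H _≟ᴴ_ using (Path; stop; _▸_; path-last; path→reach; walk→path)
  open Cycles H using (cycle-connected-avoiding)
  open DecMembership _≟ᴴ_ using () renaming (_∈?_ to _∈ᴴ?_)

  module BlockOfCycle {k₀ k₁ k₂ ks} (cycle : IsCycle H (k₀ ∷ k₁ ∷ k₂ ∷ ks)) where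

    K : List (Vtx H)
    K = k₀ ∷ k₁ ∷ k₂ ∷ ks

    Escapes : Vtx H → Vtx H → Set
    Escapes x v = Σ[ k ∈ Vtx H ] (k ∈ₗ K × k ≢ x × Reach H (_≢ x) v k)

    -- the block of H containing the cycle
    Block : Vtx H → Set
    Block v = ∀ x → x ≢ v → Escapes x v

    distinct : k₀ ≢ k₁ × k₁ ≢ k₂ × k₀ ≢ k₂
    distinct with proj₁ (proj₂ cycle)
    ... | (k₀≢k₁ ∷ k₀≢k₂ ∷ _) ∷ (k₁≢k₂ ∷ _) ∷ _ = k₀≢k₁ , k₁≢k₂ , k₀≢k₂

    cycle⊆block : ∀ {k} → k ∈ₗ K → Block k
    cycle⊆block k∈ x x≢k = _ , k∈ , ≢-sym x≢k , here (≢-sym x≢k)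

    another-cycle-vertex : ∀ x → Σ[ k ∈ Vtx H ] (k ∈ₗ K × k ≢ x)
    another-cycle-vertex x with k₀ ≟ᴴ x
    ... | yes refl = k₁ , there (here refl) , ≢-sym (proj₁ distinct)
    ... | no  k₀≢x = k₀ , here refl , k₀≢x

    next-in-block : ∀ {v w k xs} → Block v → k ∈ₗ K → Adj (vtx v) (vtx w) → Path w k xs →
                    All (v ≢_) xs → Block w
    next-in-block {xs = xs} Bv k∈ v~w p v∉ y y≢w with y ∈ᴴ? xs
    ... | no  y∉ = _ , k∈ , (λ { refl → y∉ (path-last p) }) , path→reach p λ { z∈ refl → y∉ z∈ }
    ... | yes y∈ with Bv y (λ { refl → All.lookup v∉ y∈ refl })
    ...   | k′ , k′∈ , k′≢y , v⇝k′ = k′ , k′∈ , k′≢y , step (≢-sym y≢w) (Adj-sym v~w) v⇝k′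

    path-in-block : ∀ {v k xs} → Block v → k ∈ₗ K → Path v k xs → Unique xs → ∀ {w} → w ∈ₗ xs → Block w
    path-in-block Bv _   stop      _          (here refl) = Bv
    path-in-block Bv _   (_ ▸ _)   _          (here refl) = Bv
    path-in-block Bv k∈ (v~w ▸ p) (v∉ ∷ uniq) (there w∈)  =
      path-in-block (next-in-block Bv k∈ v~w p v∉) k∈ p uniq w∈

    escape-in-block : ∀ {u x} → Block u → x ≢ u →
                      Σ[ k ∈ Vtx H ] (k ∈ₗ K × k ≢ x × Reach H (λ z → Block z × z ≢ x) u k)
    escape-in-block Bu x≢u with Bu _ x≢u
    ... | k , k∈ , k≢x , u⇝k with walk→path u⇝k
    ...   | _ , p , uniq , avoids =
      k , k∈ , k≢x , path→reach p λ z∈ → path-in-block Bu k∈ p uniq z∈ , avoids z∈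

    block-connected-minus : ∀ x → Block x → Connected H (λ v → Block v × v ≢ x)
    block-connected-minus x _ u v (Bu , u≢x) (Bv , v≢x)
      with escape-in-block Bu (≢-sym u≢x) | escape-in-block Bv (≢-sym v≢x)
    ... | k , k∈ , k≢x , u⇝k | k′ , k′∈ , k′≢x , v⇝k′ =
      reach-trans u⇝k (reach-trans along-cycle (reach-sym v⇝k′))
      where
      along-cycle : Reach H (λ v → Block v × v ≢ x) k k′
      along-cycle = reach-map (λ (z∈ , z≢x) → cycle⊆block z∈ , z≢x)
                      (cycle-connected-avoiding (λ {u} {v} → Adj-sym {vtx u} {vtx v}) _≟ᴴ_ cycle x k∈ k′∈ k≢x k′≢x)

    block-connected : Connected H Block
    block-connected u v Bu Bv
      with another-cycle-vertex u | another-cycle-vertex v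
    ... | x , x∈ , x≢u | y , y∈ , y≢v
      with escape-in-block Bu x≢u | escape-in-block Bv y≢v
    ... | k , k∈ , _ , u⇝k | k′ , k′∈ , _ , v⇝k′ =
      reach-trans (reach-map proj₁ u⇝k)
        (reach-trans (reach-map cycle⊆block (linked-reach (linked-prefix K (proj₂ (proj₂ cycle))) k∈ k′∈))
                     (reach-sym (reach-map proj₁ v⇝k′)))

    block-twoConnected : TwoConnected H Block
    block-twoConnected =
      (k₀ , k₁ , k₂ , cycle⊆block (here refl) , cycle⊆block (there (here refl)) ,
       cycle⊆block (there (there (here refl))) , distinct) ,
      block-connected , block-connected-minus

    block-maximal : ∀ W′ → _⊆ᵖ_ H Block W′ → TwoConnected H W′ →
                    ∀ v → W′ v → ∀ x → x ≢ v → ¬ ¬ Escapes x v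
    block-maximal W′ B⊆W′ (_ , connected′ , connected-minus′) v W′v x x≢v with another-cycle-vertex x
    ... | k , k∈ , k≢x = ¬¬-map escape ¬¬-excluded-middle
      where
      W′k : W′ k
      W′k = B⊆W′ k (cycle⊆block k∈)
      escape : Dec (W′ x) → Escapes x v
      escape (yes W′x) =
        k , k∈ , k≢x , reach-map proj₂ (connected-minus′ x W′x v k (W′v , ≢-sym x≢v) (W′k , k≢x))
      escape (no ¬W′x) =
        k , k∈ , k≢x , reach-map (λ { W′z refl → ¬W′x W′z }) (connected′ v k W′v W′k)

    -- Maximality of Block needs excluded middle; as adjacency is decidable we may argue under ¬ ¬,
    -- and finiteness of Vtx H lets the double negation pass through the quantifiers.
    blockGraph⇒cycle-adjacent : IsBlockGraph H → ∀ {u v} → u ∈ₗ K → v ∈ₗ K → u ≢ v →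
                                Adj (vtx u) (vtx v)
    blockGraph⇒cycle-adjacent block {u} {v} u∈ v∈ u≢v =
      decidable-stable (T? _) λ ¬uv → ¬¬-shiftᴴ (λ _ → ¬¬-shiftᴴ λ _ → stable) λ escapes-stable →
        ¬uv (block Block (block-twoConnected , maximal escapes-stable) u v (cycle⊆block u∈) (cycle⊆block v∈) u≢v)
      where
      maximal : (∀ x v → Stable (Escapes x v)) →
                ∀ W′ → _⊆ᵖ_ H Block W′ → TwoConnected H W′ → _⊆ᵖ_ H W′ Block
      maximal escapes-stable W′ B⊆W′ tc′ v W′v x x≢v =
        escapes-stable x v (block-maximal W′ B⊆W′ tc′ v W′v x x≢v)

  gVertices : List (Vtx Ĝ∖S) → List (Vtx H)
  gVertices []                        = []
  gVertices (keep (inj₁ v) v∉S ∷ zs)  = keep v v∉S ∷ gVertices zs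
  gVertices (keep (inj₂ _) _   ∷ zs)  = gVertices zs

  gVertices-++ : ∀ xs ys → gVertices (xs ++ ys) ≡ gVertices xs ++ gVertices ys
  gVertices-++ []                       ys = refl
  gVertices-++ (keep (inj₁ v) v∉S ∷ xs) ys = cong (keep v v∉S ∷_) (gVertices-++ xs ys)
  gVertices-++ (keep (inj₂ _) _   ∷ xs) ys = gVertices-++ xs ys

  gVertices-∈ : ∀ {z} xs → z ∈ₗ gVertices xs → vertex z ∈ₗ xs
  gVertices-∈ (keep (inj₁ _) _ ∷ xs) (here refl) = here refl
  gVertices-∈ (keep (inj₁ _) _ ∷ xs) (there z∈)  = there (gVertices-∈ xs z∈)
  gVertices-∈ (keep (inj₂ _) _ ∷ xs) z∈          = there (gVertices-∈ xs z∈)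

  gVertices-unique : ∀ xs → Unique xs → Unique (gVertices xs)
  gVertices-unique []                     _            = []
  gVertices-unique (keep (inj₁ _) _ ∷ xs) (v∉ ∷ uniq) =
    All.tabulate (λ z∈ → All.lookup v∉ (gVertices-∈ xs z∈) ∘ cong vertex) ∷ gVertices-unique xs uniq
  gVertices-unique (keep (inj₂ _) _ ∷ xs) (_ ∷ uniq)  = gVertices-unique xs uniq

  project-linked : ∀ {a} L → Linked (_∼_ Ĝ∖S) (vertex a ∷ L) →
                   Linked (λ u v → u ≢ v → Adj (vtx u) (vtx v)) (a ∷ gVertices L)
  project-linked []                                          _                 = [-]
  project-linked (keep (inj₁ _) _ ∷ _)                       (() ∷ _)
  project-linked (keep (inj₂ _) _ ∷ [])                      _                 = [-]
  project-linked (keep (inj₂ _) _ ∷ keep (inj₂ _) _ ∷ _)     (_ ∷ () ∷ _)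
  project-linked (keep (inj₂ _) _ ∷ keep (inj₁ _) _ ∷ L)
                 ((_ , a∈C , _) ∷ (maxC , b∈C , _) ∷ lk) =
    (λ a≢b → proj₁ maxC _ _ a∈C b∈C (a≢b ∘ keep-≡)) ∷ project-linked L lk

  project-cycle : ∀ {a L} → 3 ≤ length (a ∷ gVertices L) → IsCycle Ĝ∖S (vertex a ∷ L) →
                  IsCycle H (a ∷ gVertices L)
  project-cycle {a} {L} long (_ , uniq , linked) =
    long , uniqK , Linked.zipWith (λ (adjacent-if , u≢v) → adjacent-if u≢v)
                     (linkedK , distinct-neighbours (≤-trans (n≤1+n 2) long) uniqK)
    where
    uniqK : Unique (a ∷ gVertices L)
    uniqK = gVertices-unique (vertex a ∷ L) uniq
    linkedK : Linked (λ u v → u ≢ v → Adj (vtx u) (vtx v)) (a ∷ gVertices L ++ [ a ])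
    linkedK = subst (λ zs → Linked _ (a ∷ zs)) (gVertices-++ L [ vertex a ])
                    (project-linked (L ++ [ vertex a ]) linked)

  cycle-at-vertex : ∀ {vs} → IsCycle Ĝ∖S vs →
                    Σ[ a ∈ Vtx H ] Σ[ L ∈ List (Vtx Ĝ∖S) ] IsCycle Ĝ∖S (vertex a ∷ L)
  cycle-at-vertex {[]}                                      (() , _)
  cycle-at-vertex {keep (inj₁ a) a∉S ∷ L}                   c             = keep a a∉S , L , c
  cycle-at-vertex {keep (inj₂ _) _ ∷ []}                    (s≤s () , _)
  cycle-at-vertex {keep (inj₂ _) _ ∷ keep (inj₁ a) a∉S ∷ L} c             = keep a a∉S , _ , Cycles.rotate Ĝ∖S c
  cycle-at-vertex {keep (inj₂ _) _ ∷ keep (inj₂ _) _ ∷ _}   (_ , _ , () ∷ _)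

  vertex-≢ : ∀ {a b} .{q} → vertex a ≢ keep (inj₁ b) q → vtx a ≢ b
  vertex-≢ a≢b refl = a≢b refl

  clique-≡ : ∀ {C D : MaxClique G} .{p q} → clq C ≡ clq D →
             _≡_ {A = Vtx Ĝ∖S} (keep (inj₂ C) p) (keep (inj₂ D) q)
  clique-≡ {vC _ _} {vC _ _} refl = refl

  module _ (noD4 : ¬ InducedCopy G D4) (block : IsBlockGraph H) where

    open D4-free noD4

    no-cycle-at-vertex : ∀ a L → ¬ IsCycle Ĝ∖S (vertex a ∷ L)
    no-cycle-at-vertex a []                                          (s≤s () , _)
    no-cycle-at-vertex a (keep (inj₁ _) _ ∷ _)                       (_ , _ , () ∷ _)
    no-cycle-at-vertex a (keep (inj₂ _) _ ∷ [])                      (s≤s (s≤s ()) , _)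
    no-cycle-at-vertex a (keep (inj₂ _) _ ∷ keep (inj₂ _) _ ∷ _)     (_ , _ , _ ∷ () ∷ _)
    no-cycle-at-vertex a (_ ∷ keep (inj₁ _) _ ∷ [])                  (_ , _ , _ ∷ _ ∷ () ∷ _)
    no-cycle-at-vertex a (_ ∷ keep (inj₁ _) _ ∷ keep (inj₁ _) _ ∷ _) (_ , _ , _ ∷ _ ∷ () ∷ _)
    no-cycle-at-vertex a (_ ∷ _ ∷ keep (inj₂ _) _ ∷ keep (inj₂ _) _ ∷ _) (_ , _ , _ ∷ _ ∷ _ ∷ () ∷ _)
    no-cycle-at-vertex a (keep (inj₂ _) _ ∷ keep (inj₁ b₁) _ ∷ keep (inj₂ _) _ ∷ [])
      (_ , (_ ∷ a≢ᴳb₁ ∷ _) ∷ (_ ∷ C₀≢C₁ ∷ _) ∷ _ ,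
       (maxC₀ , a∈C₀ , _) ∷ (_ , b₁∈C₀ , _) ∷ (maxC₁ , b₁∈C₁ , _) ∷ (_ , a∈C₁ , _) ∷ [-]) =
      C₀≢C₁ (clique-≡ (maxCliques-sharing-edge maxC₀ maxC₁ a∈C₀ b₁∈C₀ a∈C₁ b₁∈C₁ (vertex-≢ {a} a≢ᴳb₁)))
    no-cycle-at-vertex a (keep (inj₂ C₀) _ ∷ keep (inj₁ b₁) q₁ ∷ keep (inj₂ C₁) _ ∷ keep (inj₁ b₂) q₂ ∷ L)
      c@(_ , (_ ∷ a≢ᴳb₁ ∷ _ ∷ a≢ᴳb₂ ∷ _) ∷ (_ ∷ C₀≢C₁ ∷ _) ∷ (_ ∷ b₁≢ᴳb₂ ∷ _) ∷ _ ,
         (maxC₀ , a∈C₀ , _) ∷ (_ , b₁∈C₀ , _) ∷ (maxC₁ , b₁∈C₁ , _) ∷ (_ , b₂∈C₁ , _) ∷ _) =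
      C₀≢C₁ (clique-≡ (maxCliques-sharing-edge maxC₀ maxC₁ b₁∈C₀ b₂∈C₀ b₁∈C₁ b₂∈C₁ b₁≢b₂))
      where
      b₁≢b₂ : b₁ ≢ b₂
      b₁≢b₂ = vertex-≢ {keep b₁ q₁} b₁≢ᴳb₂
      a~b₂ : Adj (vtx a) b₂
      a~b₂ = BlockOfCycle.blockGraph⇒cycle-adjacent (project-cycle (s≤s (s≤s (s≤s z≤n))) c) block
               (here refl) (there (there (here refl))) (a≢ᴳb₂ ∘ cong vertex)
      b₂∈C₀ : b₂ ∈ clq C₀
      b₂∈C₀ = common-neighbour∈maxClique maxC₀ a∈C₀ b₁∈C₀ (vertex-≢ {a} a≢ᴳb₁)
                (Adj-sym a~b₂) (proj₁ maxC₁ b₂ b₁ b₂∈C₁ b₁∈C₁ (≢-sym b₁≢b₂))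

    blockGraph⇒acyclic : Acyclic Ĝ∖S
    blockGraph⇒acyclic _ c with cycle-at-vertex c
    ... | a , L , c′ = no-cycle-at-vertex a L c′

lemma7 : ∀ {n} (G : SimpleGraph n) → ¬ InducedCopy G C4 → ¬ InducedCopy G D4 →
    (S : Subset n) →
    IsBlockGraph (toGraph G ∖ (λ v → v ∈ S)) ⇔ Acyclic (Ĝ G ∖ InS {n} {G} S)
lemma7 G _ noD4 S = mk⇔ (blockGraph⇒acyclic noD4) acyclic⇒blockGraph
  where open Deletion G S
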